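{- ($\Box$-primality.) For all formulas $A,B$: if $\mathsf{IEL}^{ - }\vdash\Box A\vee\Box B$, then $\mathsf{IEL}^{ - }\vdash A$ or $\mathsf{IEL}^{ - }\vdash B$.
   Context: Formulas: built from propositional atoms and $\bot$ by $\wedge,\vee,\rightarrow$ and a unary modality $\Box$. $\mathsf{IEL}^{ - }$ is the natural deduction system with the usual intuitionistic (NJ) introduction/elimination rules for $\wedge,\vee,\rightarrow$, ex falso ($\bot$-elimination), and the $\Box$-intro rule: from deductions of $\Box A_1,\dots,\Box A_n$ (from assumptions $\Gamma_1,\dots,\Gamma_n$) and a deduction of $B$ from assumptions $A_1,\dots,A_n,\Delta$, infer $\Box B$, discharging $A_1,\dots,A_n$ ($n\ge0$). $\mathsf{IEL}^{ - }\vdash A$ means $A$ has a deduction with no undischarged assumptions. -}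

module Defs where

open import Data.Nat using (ℕ)
open import Data.List using (List; []; _∷_; _++_)
open import Data.List.Membership.Propositional using (_∈_)
open import Data.List.Relation.Unary.All using (All)

data Fm : Set where
  atom : ℕ → Fm
  ⊥'   : Fm
  _∧'_ : Fm → Fm → Fm
  _∨'_ : Fm → Fm → Fm
  _⇒_  : Fm → Fm → Fm
  □_   : Fm → Fm

infixr 6 _∧'_
infixr 5 _∨'_
infixr 4 _⇒_
infix 8 □_
infix 2 _⊢_

data _⊢_ (Γ : List Fm) : Fm → Set where
  ass   : ∀ {A} → A ∈ Γ → Γ ⊢ A
  ∧I    : ∀ {A B} → Γ ⊢ A → Γ ⊢ B → Γ ⊢ A ∧' B
  ∧E₁   : ∀ {A B} → Γ ⊢ A ∧' B → Γ ⊢ A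
  ∧E₂   : ∀ {A B} → Γ ⊢ A ∧' B → Γ ⊢ B
  ∨I₁   : ∀ {A B} → Γ ⊢ A → Γ ⊢ A ∨' B
  ∨I₂   : ∀ {A B} → Γ ⊢ B → Γ ⊢ A ∨' B
  ∨E    : ∀ {A B C} → Γ ⊢ A ∨' B → (A ∷ Γ) ⊢ C → (B ∷ Γ) ⊢ C → Γ ⊢ C
  ⇒I    : ∀ {A B} → (A ∷ Γ) ⊢ B → Γ ⊢ A ⇒ B
  ⇒E    : ∀ {A B} → Γ ⊢ A ⇒ B → Γ ⊢ A → Γ ⊢ B
  ⊥E    : ∀ {A} → Γ ⊢ ⊥' → Γ ⊢ A
  -- □-intro: from deductions of □A₁,…,□Aₙ and a deduction of B from
  -- A₁,…,Aₙ together with open assumptions Δ ⊆ Γ, infer □B,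
  -- discharging A₁,…,Aₙ (n ≥ 0).
  □I    : ∀ {B} (As : List Fm) → All (λ A → Γ ⊢ □ A) As → (As ++ Γ) ⊢ B → Γ ⊢ □ B

IEL⁻⊢_ : Fm → Set
IEL⁻⊢ A = [] ⊢ A
infix 2 IEL⁻⊢_

{-# OPTIONS --safe #-}
-- A glued Aczel slash: a formula is slashed when, recursively, its disjunctions
-- pick a closed-provable slashed disjunct, its implications send closed-provable
-- slashed antecedents to such consequents, and □ A is slashed exactly when A is
-- closed-provable.  By induction on deductions, closed-provable slashed
-- assumptions yield a slashed conclusion; in the □-intro case the premises are
-- slashed boxes, hence closed proofs of the discharged Aᵢ, which are substituted
-- into the deduction of B.  Slashing □ A ∨ □ B yields the result.
module Submission where

open import Defs
open import Data.Sum using (_⊎_; inj₁; inj₂; map)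
open import Data.Product using (_×_; _,_; proj₁; proj₂)
open import Data.Unit using (⊤)
open import Data.Empty using (⊥; ⊥-elim)
open import Data.List using (List; []; _∷_; _++_)
open import Data.List.Relation.Binary.Subset.Propositional using (_⊆_)
open import Data.List.Relation.Binary.Subset.Propositional.Properties
  using (∷⁺ʳ; ++⁺ʳ; xs⊆xs++ys; xs⊆ys++xs)
open import Data.List.Relation.Unary.All as All using (All; []; _∷_; lookup; tabulate)
open import Data.List.Relation.Unary.All.Properties using (++⁺)

mutual
  wk : ∀ {Γ Δ A} → Γ ⊆ Δ → Γ ⊢ A → Δ ⊢ A
  wk ρ (ass p)      = ass (ρ p)
  wk ρ (∧I d e)     = ∧I (wk ρ d) (wk ρ e)
  wk ρ (∧E₁ d)      = ∧E₁ (wk ρ d)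
  wk ρ (∧E₂ d)      = ∧E₂ (wk ρ d)
  wk ρ (∨I₁ d)      = ∨I₁ (wk ρ d)
  wk ρ (∨I₂ d)      = ∨I₂ (wk ρ d)
  wk ρ (∨E d e f)   = ∨E (wk ρ d) (wk (∷⁺ʳ _ ρ) e) (wk (∷⁺ʳ _ ρ) f)
  wk ρ (⇒I d)       = ⇒I (wk (∷⁺ʳ _ ρ) d)
  wk ρ (⇒E d e)     = ⇒E (wk ρ d) (wk ρ e)
  wk ρ (⊥E d)       = ⊥E (wk ρ d)
  wk ρ (□I As ps d) = □I As (wk-□s ρ ps) (wk (++⁺ʳ As ρ) d)

  wk-□s : ∀ {Γ Δ As} → Γ ⊆ Δ → All (λ A → Γ ⊢ □ A) As → All (λ A → Δ ⊢ □ A) As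
  wk-□s ρ []       = []
  wk-□s ρ (p ∷ ps) = wk ρ p ∷ wk-□s ρ ps

Subst : List Fm → List Fm → Set
Subst Γ Δ = All (Δ ⊢_) Γ

exts++ : ∀ {Γ Δ} As → Subst Γ Δ → Subst (As ++ Γ) (As ++ Δ)
exts++ {Δ = Δ} As σ =
  ++⁺ (tabulate (λ p → ass (xs⊆xs++ys As Δ p))) (All.map (wk (xs⊆ys++xs Δ As)) σ)

exts : ∀ {Γ Δ A} → Subst Γ Δ → Subst (A ∷ Γ) (A ∷ Δ)
exts {A = A} = exts++ (A ∷ [])

mutual
  sub : ∀ {Γ Δ A} → Subst Γ Δ → Γ ⊢ A → Δ ⊢ A
  sub σ (ass p)      = lookup σ p
  sub σ (∧I d e)     = ∧I (sub σ d) (sub σ e)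
  sub σ (∧E₁ d)      = ∧E₁ (sub σ d)
  sub σ (∧E₂ d)      = ∧E₂ (sub σ d)
  sub σ (∨I₁ d)      = ∨I₁ (sub σ d)
  sub σ (∨I₂ d)      = ∨I₂ (sub σ d)
  sub σ (∨E d e f)   = ∨E (sub σ d) (sub (exts σ) e) (sub (exts σ) f)
  sub σ (⇒I d)       = ⇒I (sub (exts σ) d)
  sub σ (⇒E d e)     = ⇒E (sub σ d) (sub σ e)
  sub σ (⊥E d)       = ⊥E (sub σ d)
  sub σ (□I As ps d) = □I As (sub-□s σ ps) (sub (exts++ As σ) d)

  sub-□s : ∀ {Γ Δ As} → Subst Γ Δ → All (λ A → Γ ⊢ □ A) As → All (λ A → Δ ⊢ □ A) As
  sub-□s σ []       = []
  sub-□s σ (p ∷ ps) = sub σ p ∷ sub-□s σ ps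

mutual
  Glued : Fm → Set
  Glued A = (IEL⁻⊢ A) × Slash A

  Slash : Fm → Set
  Slash (atom _) = ⊤
  Slash ⊥'       = ⊥
  Slash (A ∧' B) = Glued A × Glued B
  Slash (A ∨' B) = Glued A ⊎ Glued B
  Slash (A ⇒ B)  = Glued A → Glued B
  Slash (□ A)    = IEL⁻⊢ A

closing : ∀ {Γ} → All Glued Γ → Subst Γ []
closing = All.map proj₁

mutual
  ⊢⇒glued : ∀ {Γ A} → Γ ⊢ A → All Glued Γ → Glued A
  ⊢⇒glued d γ = sub (closing γ) d , ⊢⇒slash d γ

  ⊢⇒slash : ∀ {Γ A} → Γ ⊢ A → All Glued Γ → Slash A
  ⊢⇒slash (ass p)      γ = proj₂ (lookup γ p)
  ⊢⇒slash (∧I d e)     γ = ⊢⇒glued d γ , ⊢⇒glued e γ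
  ⊢⇒slash (∧E₁ d)      γ = proj₂ (proj₁ (⊢⇒slash d γ))
  ⊢⇒slash (∧E₂ d)      γ = proj₂ (proj₂ (⊢⇒slash d γ))
  ⊢⇒slash (∨I₁ d)      γ = inj₁ (⊢⇒glued d γ)
  ⊢⇒slash (∨I₂ d)      γ = inj₂ (⊢⇒glued d γ)
  ⊢⇒slash (∨E d e f)   γ with ⊢⇒slash d γ
  ... | inj₁ a = ⊢⇒slash e (a ∷ γ)
  ... | inj₂ b = ⊢⇒slash f (b ∷ γ)
  ⊢⇒slash (⇒I d)       γ = λ a → ⊢⇒glued d (a ∷ γ)
  ⊢⇒slash (⇒E d e)     γ = proj₂ (⊢⇒slash d γ (⊢⇒glued e γ))
  ⊢⇒slash (⊥E d)       γ = ⊥-elim (⊢⇒slash d γ)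
  ⊢⇒slash (□I As ps d) γ = sub (++⁺ (⊢⇒slash-□s ps γ) (closing γ)) d

  ⊢⇒slash-□s : ∀ {Γ As} → All (λ A → Γ ⊢ □ A) As → All Glued Γ → All IEL⁻⊢_ As
  ⊢⇒slash-□s []       γ = []
  ⊢⇒slash-□s (p ∷ ps) γ = ⊢⇒slash p γ ∷ ⊢⇒slash-□s ps γ

disjunction-property : ∀ {A B} → IEL⁻⊢ A ∨' B → (IEL⁻⊢ A) ⊎ (IEL⁻⊢ B)
disjunction-property d = map proj₁ proj₁ (⊢⇒slash d [])

□-elim-admissible : ∀ {A} → IEL⁻⊢ □ A → IEL⁻⊢ A
□-elim-admissible d = ⊢⇒slash d []

corollary34 : (A B : Fm) → IEL⁻⊢ (□ A ∨' □ B) → (IEL⁻⊢ A) ⊎ (IEL⁻⊢ B)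
corollary34 A B d = map □-elim-admissible □-elim-admissible (disjunction-property d)
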